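{- Let $T$ be a monad and $F$ an endofunctor on $\mathbf{Sets}$ such that: $\mathcal{K}\ell(T)$ is $\mathbf{Cppo}$-enriched with left-strict composition; there is a distributive law $\lambda\colon FT\Rightarrow TF$ whose induced lifting $\overline{F}$ is locally monotone; and $F$ preserves $\omega$-colimits. Let $(\alpha_n\colon F^n\emptyset\to A)_{n<\omega}$ be the colimit cocone in $\mathbf{Sets}$ of the initial sequence $\emptyset\to F\emptyset\to F^2\emptyset\to\cdots$ (whose maps are $F^n¡$, $¡\colon\emptyset\to F\emptyset$). If $J\alpha_n$ is an embedding in $\mathcal{K}\ell(T)$ with corresponding projection $(J\alpha_n)^P$, then $\overline{F}J\alpha_n$ is an embedding whose corresponding projection is $\overline{F}\big((J\alpha_n)^P\big)$, i.e. $(\overline{F}J\alpha_n)^P=\overline{F}\big((J\alpha_n)^P\big)$.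
   Context: $\mathcal{K}\ell(T)$: objects sets, arrows $X\to Y$ functions $X\to TY$, identities $\eta_X$, composition $g\circ f=\mu_Z\circ Tg\circ f$; $J\colon\mathbf{Sets}\to\mathcal{K}\ell(T)$, $JX=X$, $Jf=\eta_Y\circ f$. A distributive law $\lambda$ is natural with $\lambda\circ F\eta=\eta F$ and $\lambda\circ F\mu=\mu F\circ T\lambda\circ\lambda T$; induced lifting $\overline{F}X=FX$, $\overline{F}f=\lambda_Y\circ Ff$. $\mathbf{Cppo}$-enriched: hom-sets partial orders with least element, joins of increasing $\omega$-chains, composition preserving such joins in each argument; left-strict: $\bot\circ f=\bot$; locally monotone: $f\sqsubseteq g\Rightarrow\overline{F}f\sqsubseteq\overline{F}g$. An embedding-projection pair is $e\colon X\to Y$, $p\colon Y\to X$ with $p\circ e=\mathrm{id}$ and $e\circ p\sqsubseteq\mathrm{id}$; the projection of an embedding $e$ is unique and denoted $e^P$. -}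

module Defs where

open import Data.Nat using (ℕ; zero; suc)
open import Data.Empty using (⊥; ⊥-elim)
open import Data.Product using (Σ; _×_; _,_)
open import Function using (_∘_; id)
open import Relation.Binary.PropositionalEquality using (_≡_; _≗_)

-- The category Sets is modelled by Agda's Set (= Set₀); equality of
-- functions (morphisms) is pointwise equality _≗_ (Sets is extensional).

record Functor (F : Set → Set) : Set₁ where
  field
    fmap    : {X Y : Set} → (X → Y) → F X → F Y
    fmap-cong : {X Y : Set} {f g : X → Y} → f ≗ g → fmap f ≗ fmap g
    fmap-id : {X : Set} → fmap (id {A = X}) ≗ id
    fmap-∘  : {X Y Z : Set} (g : Y → Z) (f : X → Y) →
              fmap (g ∘ f) ≗ fmap g ∘ fmap f

record Monad (T : Set → Set) : Set₁ where
  field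
    functor : Functor T
  open Functor functor public
  field
    η : {X : Set} → X → T X
    μ : {X : Set} → T (T X) → T X
    η-nat : {X Y : Set} (f : X → Y) → fmap f ∘ η ≗ η ∘ f
    μ-nat : {X Y : Set} (f : X → Y) → fmap f ∘ μ ≗ μ ∘ fmap (fmap f)
    μ-η   : {X : Set} → μ ∘ η {T X} ≗ id
    μ-Tη  : {X : Set} → μ ∘ fmap (η {X}) ≗ id
    μ-μ   : {X : Set} → μ ∘ μ {T X} ≗ μ ∘ fmap (μ {X})

module Kleisli {T : Set → Set} (M : Monad T) where
  open Monad M

  Kl : Set → Set → Set
  Kl X Y = X → T Y

  idK : {X : Set} → Kl X X
  idK = η

  infixr 9 _⊙_
  _⊙_ : {X Y Z : Set} → Kl Y Z → Kl X Y → Kl X Z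
  g ⊙ f = μ ∘ fmap g ∘ f

  J : {X Y : Set} → (X → Y) → Kl X Y
  J f = η ∘ f

record CppoEnriched {T : Set → Set} (M : Monad T) : Set₁ where
  open Kleisli M
  field
    _⊑_ : {X Y : Set} → Kl X Y → Kl X Y → Set
  infix 4 _⊑_
  field
    ⊑-reflexive : {X Y : Set} {f g : Kl X Y} → f ≗ g → f ⊑ g
    ⊑-trans : {X Y : Set} {f g h : Kl X Y} → f ⊑ g → g ⊑ h → f ⊑ h
    ⊑-antisym : {X Y : Set} {f g : Kl X Y} → f ⊑ g → g ⊑ f → f ≗ g
    ⊥K : {X Y : Set} → Kl X Y
    ⊥K-least : {X Y : Set} (f : Kl X Y) → ⊥K ⊑ f
    ⨆ : {X Y : Set} (c : ℕ → Kl X Y) → (∀ n → c n ⊑ c (suc n)) → Kl X Y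
    ⨆-upper : {X Y : Set} (c : ℕ → Kl X Y) (inc : ∀ n → c n ⊑ c (suc n)) →
              ∀ n → c n ⊑ ⨆ c inc
    ⨆-least : {X Y : Set} (c : ℕ → Kl X Y) (inc : ∀ n → c n ⊑ c (suc n)) →
              (u : Kl X Y) → (∀ n → c n ⊑ u) → ⨆ c inc ⊑ u
    ⊙-monoˡ : {X Y Z : Set} {g g' : Kl Y Z} (f : Kl X Y) → _⊑_ {Y} {Z} g g' → g ⊙ f ⊑ g' ⊙ f
    ⊙-monoʳ : {X Y Z : Set} (g : Kl Y Z) {f f' : Kl X Y} → _⊑_ {X} {Y} f f' → g ⊙ f ⊑ g ⊙ f'
    ⊙-contˡ : {X Y Z : Set} (c : ℕ → Kl Y Z) (inc : ∀ n → c n ⊑ c (suc n)) (f : Kl X Y) →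
              ⨆ c inc ⊙ f ≗ ⨆ (λ n → c n ⊙ f) (λ n → ⊙-monoˡ f (inc n))
    ⊙-contʳ : {X Y Z : Set} (g : Kl Y Z) (c : ℕ → Kl X Y) (inc : ∀ n → c n ⊑ c (suc n)) →
              g ⊙ ⨆ c inc ≗ ⨆ (λ n → g ⊙ c n) (λ n → ⊙-monoʳ g (inc n))

LeftStrict : {T : Set → Set} {M : Monad T} → CppoEnriched M → Set₁
LeftStrict {M = M} C = {X Y Z : Set} (f : Kl X Y) → ⊥K {Y} {Z} ⊙ f ≗ ⊥K
  where open Kleisli M
        open CppoEnriched C

record DistLaw {T F : Set → Set} (M : Monad T) (FF : Functor F) : Set₁ where
  open Monad M renaming (fmap to Tmap)
  open Functor FF renaming (fmap to Fmap)
  field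
    dl : {X : Set} → F (T X) → T (F X)
    dl-nat : {X Y : Set} (f : X → Y) → dl ∘ Fmap (Tmap f) ≗ Tmap (Fmap f) ∘ dl
    dl-η : {X : Set} → dl ∘ Fmap (η {X}) ≗ η
    dl-μ : {X : Set} → dl ∘ Fmap (μ {X}) ≗ μ ∘ Tmap dl ∘ dl

Lift : {T F : Set → Set} {M : Monad T} {FF : Functor F} → DistLaw M FF →
       {X Y : Set} → Kleisli.Kl M X Y → Kleisli.Kl M (F X) (F Y)
Lift {FF = FF} D f = DistLaw.dl D ∘ Functor.fmap FF f

LocallyMonotone : {T F : Set → Set} {M : Monad T} {FF : Functor F} →
                  CppoEnriched M → DistLaw M FF → Set₁
LocallyMonotone {M = M} {FF = FF} C D = {X Y : Set} {f g : Kleisli.Kl M X Y} →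
  CppoEnriched._⊑_ C f g → CppoEnriched._⊑_ C (Lift {FF = FF} D f) (Lift {FF = FF} D g)

record ωChain : Set₁ where
  field
    obj : ℕ → Set
    arr : (n : ℕ) → obj n → obj (suc n)

record Cocone (D : ωChain) (A : Set) : Set where
  open ωChain D
  field
    inj : (n : ℕ) → obj n → A
    commute : (n : ℕ) → inj (suc n) ∘ arr n ≗ inj n

IsColimit : {D : ωChain} {A : Set} → Cocone D A → Set₁
IsColimit {D} {A} α = (B : Set) (β : Cocone D B) →
  Σ (A → B) λ u →
    ((n : ℕ) → u ∘ Cocone.inj α n ≗ Cocone.inj β n) ×
    ((v : A → B) → ((n : ℕ) → v ∘ Cocone.inj α n ≗ Cocone.inj β n) → v ≗ u)

mapChain : {F : Set → Set} → Functor F → ωChain → ωChain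
mapChain {F} FF D = record
  { obj = λ n → F (ωChain.obj D n)
  ; arr = λ n → Functor.fmap FF (ωChain.arr D n) }

mapCocone : {F : Set → Set} (FF : Functor F) {D : ωChain} {A : Set} →
            Cocone D A → Cocone (mapChain FF D) (F A)
mapCocone FF {D} α = record
  { inj = λ n → Functor.fmap FF (Cocone.inj α n)
  ; commute = λ n x →
      trans (sym (Functor.fmap-∘ FF (Cocone.inj α (suc n)) (ωChain.arr D n) x))
            (Functor.fmap-cong FF (Cocone.commute α n) x) }
  where open import Relation.Binary.PropositionalEquality using (trans; sym)

PreservesωColimits : {F : Set → Set} → Functor F → Set₁
PreservesωColimits FF = (D : ωChain) (A : Set) (α : Cocone D A) →
  IsColimit α → IsColimit (mapCocone FF α)

Fpow : {F : Set → Set} → Functor F → ℕ → Set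
Fpow {F} FF zero = ⊥
Fpow {F} FF (suc n) = F (Fpow FF n)

initArr : {F : Set → Set} (FF : Functor F) (n : ℕ) → Fpow FF n → Fpow FF (suc n)
initArr FF zero = ⊥-elim
initArr FF (suc n) = Functor.fmap FF (initArr FF n)

initialChain : {F : Set → Set} → Functor F → ωChain
initialChain FF = record { obj = Fpow FF ; arr = initArr FF }

IsEP : {T : Set → Set} {M : Monad T} (C : CppoEnriched M) {X Y : Set} →
       Kleisli.Kl M X Y → Kleisli.Kl M Y X → Set
IsEP {M = M} C e p = (p ⊙ e ≗ idK) × (e ⊙ p ⊑ idK)
  where open Kleisli M
        open CppoEnriched C

module Submission where

-- The lifting F̄ induced by a distributive law λ : FT ⇒ TF is
-- a functor on Kl(T): it preserves identities (by the unit axiom of λ) and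
-- composition (by the multiplication axiom and naturality of λ).  Any
-- functor preserves the equation p ∘ e = id, and a locally monotone one
-- also preserves the inequation e ∘ p ⊑ id.  Hence a locally monotone
-- lifting sends every embedding-projection pair (e , p) to an
-- embedding-projection pair (F̄e , F̄p); since projections are unique this
-- says (F̄e)ᴾ = F̄(eᴾ).  The theorem is the instance e = Jαₙ.

open import Defs
open import Data.Nat using (ℕ)
open import Data.Product using (_,_)
open import Function using (_∘_)
open import Relation.Binary.PropositionalEquality

module LiftingFunctor {T F : Set → Set} (M : Monad T) (FF : Functor F)
                      (D : DistLaw M FF) where
  open Kleisli M
  open Monad M renaming (fmap to Tmap; fmap-∘ to Tmap-∘)
  open Functor FF renaming (fmap to Fmap; fmap-cong to Fmap-cong;
                            fmap-∘ to Fmap-∘)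
  open DistLaw D

  lift-cong : {X Y : Set} {f g : Kl X Y} → f ≗ g → Lift D f ≗ Lift D g
  lift-cong f≗g x = cong dl (Fmap-cong f≗g x)

  lift-id : {X : Set} → Lift D (idK {X}) ≗ idK
  lift-id = dl-η

  lift-⊙ : {X Y Z : Set} (g : Kl Y Z) (f : Kl X Y) →
           Lift D (g ⊙ f) ≗ Lift D g ⊙ Lift D f
  lift-⊙ g f x = begin
    dl (Fmap (μ ∘ Tmap g ∘ f) x)
      ≡⟨ cong dl (Fmap-∘ μ (Tmap g ∘ f) x) ⟩
    dl (Fmap μ (Fmap (Tmap g ∘ f) x))
      ≡⟨ dl-μ (Fmap (Tmap g ∘ f) x) ⟩
    μ (Tmap dl (dl (Fmap (Tmap g ∘ f) x)))
      ≡⟨ cong (μ ∘ Tmap dl ∘ dl) (Fmap-∘ (Tmap g) f x) ⟩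
    μ (Tmap dl (dl (Fmap (Tmap g) (Fmap f x))))
      ≡⟨ cong (μ ∘ Tmap dl) (dl-nat g (Fmap f x)) ⟩
    μ (Tmap dl (Tmap (Fmap g) (dl (Fmap f x))))
      ≡⟨ cong μ (sym (Tmap-∘ dl (Fmap g) (dl (Fmap f x)))) ⟩
    μ (Tmap (dl ∘ Fmap g) (dl (Fmap f x)))
      ∎
    where open ≡-Reasoning

  lift-preserves-EP : (C : CppoEnriched M) → LocallyMonotone C D →
                      {X Y : Set} (e : Kl X Y) (p : Kl Y X) →
                      IsEP C e p → IsEP C (Lift D e) (Lift D p)
  lift-preserves-EP C mono e p (p⊙e≗id , e⊙p⊑id) =
    (λ x → begin
      (Lift D p ⊙ Lift D e) x ≡⟨ sym (lift-⊙ p e x) ⟩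
      Lift D (p ⊙ e) x        ≡⟨ lift-cong p⊙e≗id x ⟩
      Lift D idK x            ≡⟨ lift-id x ⟩
      idK x                   ∎)
    , ⊑-trans (⊑-reflexive (λ x → sym (lift-⊙ e p x)))
        (⊑-trans (mono e⊙p⊑id) (⊑-reflexive lift-id))
    where
    open CppoEnriched C
    open ≡-Reasoning

lemma3p7 : (T F : Set → Set) (M : Monad T) (FF : Functor F)
    (C : CppoEnriched M) → LeftStrict C →
    (D : DistLaw M FF) → LocallyMonotone C D →
    PreservesωColimits FF →
    (A : Set) (α : Cocone (initialChain FF) A) → IsColimit α →
    (n : ℕ) (p : Kleisli.Kl M A (Fpow FF n)) →
    IsEP C (Kleisli.J M (Cocone.inj α n)) p →
    IsEP C (Lift D (Kleisli.J M (Cocone.inj α n))) (Lift D p)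
lemma3p7 T F M FF C _ D mono _ A α _ n p ep =
  LiftingFunctor.lift-preserves-EP M FF D C mono
    (Kleisli.J M (Cocone.inj α n)) p ep
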